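{- Let $x,y,z:[m]\to[s]$ be the probe-location functions of a three-array scheme. If $s<\frac1{600}m^{1-\frac{1}{\lfloor n/4\rfloor+1}}$, then $G_{A,B}([m])$ contains a cycle $C_1$ and $G_{B,C}([m])$ contains a cycle $C_2$, each of length at most $\frac n2$, such that some edge of $C_1$ and some edge of $C_2$ carry the same label.
   Context: A three-array scheme has memory consisting of three bit arrays $A[1..s],B[1..s],C[1..s]$, and each $u\in[m]$ has probe locations $x(u)\in A$, $y(u)\in B$, $z(u)\in C$. $G_{A,B}([m])$ is the bipartite multigraph with vertex classes $A=[s]$, $B=[s]$ and, for each $u\in[m]$, an edge labelled $u$ joining $x(u)\in A$ and $y(u)\in B$; $G_{B,C}([m])$ is defined analogously with edges labelled $u$ joining $y(u)\in B$ and $z(u)\in C$. (The paper states this in the setting of the ALL-EQUAL query function.) -}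

module Defs where

open import Data.Nat using (ℕ; zero; suc; _+_; _*_; _^_; _≤_; _<_)
open import Data.Nat.DivMod using (_%_; m%n<n)
open import Data.Fin using (Fin; toℕ; fromℕ<)
open import Data.Product using (Σ; ∃; _×_; _,_)
open import Data.Sum using (_⊎_)
open import Relation.Binary.PropositionalEquality using (_≡_; _≢_)
open import Function.Definitions using (Injective)

next : ∀ {h} → Fin (suc h) → Fin (suc h)
next {h} i = fromℕ< (m%n<n (suc (toℕ i)) (suc h))

-- A cycle in the bipartite multigraph with vertex classes L = [s], R = [s]
-- and, for each label u ∈ [m], an edge labelled u joining  p u ∈ L  and  q u ∈ R.
-- A cycle of length 2·(suc half) is given by distinct left vertices
-- a 0, …, a half, distinct right vertices b 0, …, b half and pairwise distinct
-- edge labels fwd i (joining a i and b i) and bwd i (joining b i and a (i+1 mod (half+1))):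
--   a0 –fwd0– b0 –bwd0– a1 –fwd1– b1 – … – b_half –bwd_half– a0 .
-- (half = 0 gives a 2-cycle formed by two parallel edges with distinct labels.)
record Cycle {m s : ℕ} (p q : Fin m → Fin s) : Set where
  field
    half     : ℕ
    a        : Fin (suc half) → Fin s
    b        : Fin (suc half) → Fin s
    fwd      : Fin (suc half) → Fin m
    bwd      : Fin (suc half) → Fin m
    a-inj    : Injective _≡_ _≡_ a
    b-inj    : Injective _≡_ _≡_ b
    fwd-inj  : Injective _≡_ _≡_ fwd
    bwd-inj  : Injective _≡_ _≡_ bwd
    fwd≢bwd  : ∀ i j → fwd i ≢ bwd j
    fwd-ends : ∀ i → p (fwd i) ≡ a i × q (fwd i) ≡ b i
    bwd-ends : ∀ i → q (bwd i) ≡ b i × p (bwd i) ≡ a (next i)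

  length : ℕ
  length = 2 * suc half

open Cycle public

HasLabel : ∀ {m s} {p q : Fin m → Fin s} → Cycle p q → Fin m → Set
HasLabel C u = (∃ λ i → fwd C i ≡ u) ⊎ (∃ λ i → bwd C i ≡ u)

module Submission where

-- Fix a degree threshold d and a length k with 2s < dᵏ.  If a set S of labels has more than d·2s
-- elements, repeatedly deleting a vertex of positive degree ≤ d together with its edges keeps
-- d·#(non-isolated vertices) < |S|, so it stops at a non-empty core of minimum degree > d.  From an
-- edge of the core there are dᵏ non-backtracking walks of length k with pairwise different edge
-- sequences; as dᵏ exceeds the number 2s of vertices, two of them end at the same vertex.  Following
-- one of them up to the vertex just after their last divergence and returning along the other gives
-- a closed non-backtracking walk of length ≤ 2k, which contains a cycle of length ≤ 2k.  Deleting
-- the labels of such cycles of G_{A,B} while more than d·2s labels remain leaves a set S₁ with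
-- |S₁| ≤ d·2s all of whose non-members lie on a short cycle of G_{A,B}.  If m > 4ds, the complement
-- of S₁ carries a short cycle of G_{B,C}, and each of its labels lies on a short cycle of G_{A,B}.
-- Taking d = ⌊(m−1)/4s⌋ and k = ⌊n/4⌋, the hypothesis forces 2s < dᵏ.

open import Defs
open import Data.Bool using (Bool; true; false; T; not; _∧_; if_then_else_)
open import Data.Empty using (⊥; ⊥-elim)
open import Data.Fin using (Fin; zero; suc; toℕ; splitAt; join; finToFun; funToFin; combine)
import Data.Fin.Properties as Finₚ
open import Data.Nat using (ℕ; zero; suc; _+_; _*_; _∸_; _^_; _≤_; _<_; z≤n; s≤s; s≤s⁻¹; _<ᵇ_)
open import Data.Nat.Properties
open import Data.Nat.DivMod using (_/_; _%_; m≡m%n+[m/n]*n; m%n<n; m/n*n≤m; m<n⇒m%n≡m; n%n≡0)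
open import Data.Nat.Tactic.RingSolver using (solve-∀)
open import Data.Product using (Σ; ∃; _×_; _,_; proj₁; proj₂)
import Data.Product as Product
open import Data.Sum using (_⊎_; inj₁; inj₂)
import Data.Sum as Sum
open import Data.Sum.Properties using (≡-dec; inj₁-injective; swap-involutive)
open import Data.Vec.Functional using (_∷_)
open import Function using (_∘_; flip; id)
open import Function.Definitions using (Injective)
open import Relation.Binary.Definitions using (DecidableEquality; tri<; tri≈; tri>)
open import Relation.Binary.PropositionalEquality
open import Relation.Nullary using (¬_; Dec; yes; no)
open import Relation.Nullary.Decidable using (⌊_⌋; toWitness; fromWitness; _×-dec_; _⊎-dec_)

-- Sets of labels as boolean predicates

infix 4 _∈_ _∉_ _⊆_
infixl 6 _∩_ _─_

_∈_ : ∀ {n} → Fin n → (Fin n → Bool) → Set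
u ∈ S = T (S u)

_∉_ : ∀ {n} → Fin n → (Fin n → Bool) → Set
u ∉ S = ¬ u ∈ S

_⊆_ : ∀ {n} → (Fin n → Bool) → (Fin n → Bool) → Set
S ⊆ R = ∀ {u} → u ∈ S → u ∈ R

_∩_ _─_ : ∀ {n} → (Fin n → Bool) → (Fin n → Bool) → Fin n → Bool
(S ∩ R) u = S u ∧ R u
(S ─ R) u = S u ∧ not (R u)

∁ : ∀ {n} → (Fin n → Bool) → Fin n → Bool
∁ S u = not (S u)

⁅_⁆ : ∀ {n} → Fin n → Fin n → Bool
⁅ e ⁆ u = ⌊ u Finₚ.≟ e ⌋

∈-∩ : ∀ {n} {S R : Fin n → Bool} {u} → u ∈ S → u ∈ R → u ∈ S ∩ R
∈-∩ {S = S} {R} {u} u∈S u∈R with S u | R u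
... | true | true = _

∈-∩⁻ : ∀ {n} {S R : Fin n → Bool} {u} → u ∈ S ∩ R → u ∈ S × u ∈ R
∈-∩⁻ {S = S} {R} {u} u∈ with S u | R u
... | true | true = _ , _

∈-─⁻ : ∀ {n} {S R : Fin n → Bool} {u} → u ∈ S ─ R → u ∈ S × u ∉ R
∈-─⁻ {S = S} {R} {u} u∈ with S u | R u
... | true | false = _ , λ ()

∉-─ : ∀ {n} {S R : Fin n → Bool} {u} → u ∉ S ─ R → u ∉ S ⊎ u ∈ R
∉-─ {S = S} {R} {u} u∉ with S u | R u
... | false | _     = inj₁ λ ()
... | true  | true  = inj₂ _
... | true  | false = ⊥-elim (u∉ _)

─-⊆ : ∀ {n} (S R : Fin n → Bool) → S ─ R ⊆ S
─-⊆ S R u∈ = proj₁ (∈-─⁻ {S = S} {R} u∈)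

∈-∁ : ∀ {n} {S : Fin n → Bool} {u} → u ∈ ∁ S → u ∉ S
∈-∁ {S = S} {u} u∈ with S u
... | false = λ ()

∈-⁅⁆ : ∀ {n} {e u : Fin n} → u ∈ ⁅ e ⁆ → u ≡ e
∈-⁅⁆ = toWitness

count : ∀ {n} → (Fin n → Bool) → ℕ
count {zero}  S = 0
count {suc n} S = if S zero then suc (count (S ∘ suc)) else count (S ∘ suc)

count≤n : ∀ {n} (S : Fin n → Bool) → count S ≤ n
count≤n {zero}  S = z≤n
count≤n {suc n} S with S zero
... | true  = s≤s (count≤n (S ∘ suc))
... | false = m≤n⇒m≤1+n (count≤n (S ∘ suc))

count-mono : ∀ {n} {S R : Fin n → Bool} → S ⊆ R → count S ≤ count R
count-mono {zero}          S⊆R = z≤n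
count-mono {suc n} {S} {R} S⊆R with S zero | R zero | S⊆R {zero}
... | true  | true  | _ = s≤s (count-mono {S = S ∘ suc} {R ∘ suc} S⊆R)
... | true  | false | h = ⊥-elim (h _)
... | false | true  | _ = m≤n⇒m≤1+n (count-mono {S = S ∘ suc} {R ∘ suc} S⊆R)
... | false | false | _ = count-mono {S = S ∘ suc} {R ∘ suc} S⊆R

count-mono-< : ∀ {n} {S R : Fin n → Bool} {u} → S ⊆ R → u ∈ R → u ∉ S → count S < count R
count-mono-< {suc n} {S} {R} {zero} S⊆R u∈R u∉S with S zero | R zero
... | true  | _    = ⊥-elim (u∉S _)
... | false | true = s≤s (count-mono {S = S ∘ suc} {R ∘ suc} S⊆R)
count-mono-< {suc n} {S} {R} {suc u} S⊆R u∈R u∉S with S zero | R zero | S⊆R {zero}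
... | true  | true  | _ = s≤s (count-mono-< {S = S ∘ suc} {R ∘ suc} S⊆R u∈R u∉S)
... | true  | false | h = ⊥-elim (h _)
... | false | true  | _ = m≤n⇒m≤1+n (count-mono-< {S = S ∘ suc} {R ∘ suc} S⊆R u∈R u∉S)
... | false | false | _ = count-mono-< {S = S ∘ suc} {R ∘ suc} S⊆R u∈R u∉S

∈⇒0<count : ∀ {n} {S : Fin n → Bool} {u} → u ∈ S → 0 < count S
∈⇒0<count {S = S} {zero} u∈S with S zero
... | true = s≤s z≤n
∈⇒0<count {S = S} {suc u} u∈S with S zero
... | true  = s≤s z≤n
... | false = ∈⇒0<count {S = S ∘ suc} u∈S

0<count⇒∃∈ : ∀ {n} (S : Fin n → Bool) → 0 < count S → ∃ λ u → u ∈ S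
0<count⇒∃∈ {suc n} S pos with S zero in eq
... | true  = zero , subst T (sym eq) _
... | false with 0<count⇒∃∈ (S ∘ suc) pos
...   | u , u∈S = suc u , u∈S

count-split : ∀ {n} (S R : Fin n → Bool) → count S ≡ count (S ∩ R) + count (S ─ R)
count-split {zero}  S R = refl
count-split {suc n} S R with S zero | R zero
... | true  | true  = cong suc (count-split (S ∘ suc) (R ∘ suc))
... | true  | false = trans (cong suc (count-split (S ∘ suc) (R ∘ suc))) (sym (+-suc _ _))
... | false | _     = count-split (S ∘ suc) (R ∘ suc)

count-empty : ∀ {n} (S : Fin n → Bool) → (∀ u → u ∉ S) → count S ≡ 0
count-empty {zero}  S empty = refl
count-empty {suc n} S empty with S zero | empty zero
... | true  | ∉ = ⊥-elim (∉ _)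
... | false | _ = count-empty (S ∘ suc) (empty ∘ suc)

count-subsingleton : ∀ {n} (S : Fin n → Bool) → (∀ {u v} → u ∈ S → v ∈ S → u ≡ v) →
                     count S ≤ 1
count-subsingleton {zero}  S unique = z≤n
count-subsingleton {suc n} S unique with S zero in eq
... | true  = s≤s (≤-reflexive (count-empty (S ∘ suc) λ u u∈S →
                Finₚ.0≢1+n (unique (subst T (sym eq) _) u∈S)))
... | false = count-subsingleton (S ∘ suc) (λ u∈S v∈S → Finₚ.suc-injective (unique u∈S v∈S))

count-remove-one : ∀ {n} (S : Fin n → Bool) (e : Fin n) → count S ≤ suc (count (S ─ ⁅ e ⁆))
count-remove-one S e = begin
  count S                                  ≡⟨ count-split S ⁅ e ⁆ ⟩
  count (S ∩ ⁅ e ⁆) + count (S ─ ⁅ e ⁆)   ≤⟨ +-monoˡ-≤ _ (count-subsingleton (S ∩ ⁅ e ⁆) unique) ⟩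
  suc (count (S ─ ⁅ e ⁆))                  ∎
  where
  open ≤-Reasoning
  is-e : ∀ {u} → u ∈ S ∩ ⁅ e ⁆ → u ≡ e
  is-e u∈ = ∈-⁅⁆ {e = e} (proj₂ (∈-∩⁻ {S = S} {⁅ e ⁆} u∈))
  unique : ∀ {u v} → u ∈ S ∩ ⁅ e ⁆ → v ∈ S ∩ ⁅ e ⁆ → u ≡ v
  unique u∈ v∈ = trans (is-e u∈) (sym (is-e v∈))

count-all : ∀ n → count {n} (λ _ → true) ≡ n
count-all zero    = refl
count-all (suc n) = cong suc (count-all n)

count-complement : ∀ {n} (S : Fin n → Bool) → count S + count (∁ S) ≡ n
count-complement {n} S = trans (sym (count-split (λ _ → true) S)) (count-all n)

count-∁-large : ∀ {n} (S : Fin n → Bool) {b} → b + b < n → count S ≤ b → b < count (∁ S)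
count-∁-large {n} S {b} b+b<n small = +-cancelˡ-< b _ _ (begin-strict
  b + b                  <⟨ b+b<n ⟩
  n                      ≡⟨ count-complement S ⟨
  count S + count (∁ S)  ≤⟨ +-monoˡ-≤ _ small ⟩
  b + count (∁ S)        ∎)
  where open ≤-Reasoning

distinct-members : ∀ {n d} (S : Fin n → Bool) → d ≤ count S →
                   Σ (Fin d → Fin n) λ f → Injective _≡_ _≡_ f × (∀ c → f c ∈ S)
distinct-members {d = zero} S _ = (λ ()) , (λ { {()} }) , λ ()
distinct-members {suc n} {suc d} S d<count with S zero in eq
... | false with distinct-members (S ∘ suc) d<count
...   | f , f-inj , f∈S = suc ∘ f , f-inj ∘ Finₚ.suc-injective , f∈S
distinct-members {suc n} {suc d} S d<count | true with distinct-members (S ∘ suc) (s≤s⁻¹ d<count)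
...   | f , f-inj , f∈S = zero ∷ suc ∘ f , inj , λ { zero → subst T (sym eq) _ ; (suc c) → f∈S c }
  where
  inj : Injective _≡_ _≡_ (zero ∷ suc ∘ f)
  inj {zero}  {zero}  _ = refl
  inj {suc x} {suc y} e = cong suc (f-inj (Finₚ.suc-injective e))

∸-suc : ∀ {m n} → n < m → m ∸ n ≡ suc (m ∸ suc n)
∸-suc {suc m} {zero}  _         = refl
∸-suc {suc m} {suc n} (s≤s n<m) = ∸-suc n<m

split-at : ∀ L t → t < L ⊎ ∃ λ i → t ≡ L + i
split-at L t with t <? L
... | yes t<L = inj₁ t<L
... | no  t≮L = inj₂ (t ∸ L , sym (m+[n∸m]≡n (≮⇒≥ t≮L)))

parity : ∀ n → (∃ λ t → n ≡ 2 * t) ⊎ (∃ λ t → n ≡ suc (2 * t))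
parity zero = inj₁ (0 , refl)
parity (suc n) with parity n
... | inj₁ (t , n≡2t)   = inj₂ (t , cong suc n≡2t)
... | inj₂ (t , n≡2t+1) = inj₁ (suc t , trans (cong suc n≡2t+1) (sym (*-suc 2 t)))

side : ∀ {A B : Set} (x : A ⊎ B) → (∃ λ a → x ≡ inj₁ a) ⊎ (∃ λ b → x ≡ inj₂ b)
side (inj₁ a) = inj₁ (a , refl)
side (inj₂ b) = inj₂ (b , refl)

swap-injective : ∀ {A B : Set} {x y : A ⊎ B} → Sum.swap x ≡ Sum.swap y → x ≡ y
swap-injective {x = x} {y} eq =
  trans (sym (swap-involutive x)) (trans (cong Sum.swap eq) (swap-involutive y))

join-injective : ∀ a b {α β : Fin a ⊎ Fin b} → join a b α ≡ join a b β → α ≡ β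
join-injective a b {α} {β} eq =
  trans (sym (Finₚ.splitAt-join a b α)) (trans (cong (splitAt a) eq) (Finₚ.splitAt-join a b β))

funToFin-cong : ∀ {k d} {f g : Fin k → Fin d} → f ≗ g → funToFin f ≡ funToFin g
funToFin-cong {zero}  f≗g = refl
funToFin-cong {suc k} f≗g = cong₂ combine (f≗g zero) (funToFin-cong (f≗g ∘ suc))

finToFun-injective : ∀ {d k} {i j : Fin (d ^ k)} → finToFun {d} {k} i ≗ finToFun j → i ≡ j
finToFun-injective {d} {k} {i} {j} same =
  trans (sym (Finₚ.funToFin-finToFin {k} {d} i))
        (trans (funToFin-cong {k} {d} same) (Finₚ.funToFin-finToFin {k} {d} j))

next-cases : ∀ {h} (i : Fin (suc h)) →
             (toℕ i < h × toℕ (next i) ≡ suc (toℕ i)) ⊎ (toℕ i ≡ h × toℕ (next i) ≡ 0)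
next-cases {h} i with m≤n⇒m<n∨m≡n (Finₚ.toℕ≤pred[n] i)
... | inj₁ i<h = inj₁ (i<h , trans (Finₚ.toℕ-fromℕ< _) (m<n⇒m%n≡m (s≤s i<h)))
... | inj₂ i≡h = inj₂ (i≡h , trans (Finₚ.toℕ-fromℕ< _)
                                   (trans (cong (λ j → suc j % suc h) i≡h) (n%n≡0 (suc h))))

next-injective : ∀ {h} {i j : Fin (suc h)} → next i ≡ next j → i ≡ j
next-injective {i = i} {j} eq with next-cases i | next-cases j
... | inj₁ (_ , ni≡) | inj₁ (_ , nj≡) =
  Finₚ.toℕ-injective (suc-injective (trans (sym ni≡) (trans (cong toℕ eq) nj≡)))
... | inj₂ (i≡h , _) | inj₂ (j≡h , _) = Finₚ.toℕ-injective (trans i≡h (sym j≡h))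
... | inj₁ (_ , ni≡) | inj₂ (_ , nj≡) with () ← trans (sym ni≡) (trans (cong toℕ eq) nj≡)
... | inj₂ (_ , ni≡) | inj₁ (_ , nj≡) with () ← trans (sym nj≡) (trans (cong toℕ (sym eq)) ni≡)

EdgesIn : ∀ {m s} {p q : Fin m → Fin s} → (Fin m → Bool) → Cycle p q → Set
EdgesIn S C = ∀ {u} → HasLabel C u → u ∈ S

hasLabel? : ∀ {m s} {p q : Fin m → Fin s} (C : Cycle p q) u → Dec (HasLabel C u)
hasLabel? C u = Finₚ.any? (λ i → fwd C i Finₚ.≟ u) ⊎-dec Finₚ.any? (λ i → bwd C i Finₚ.≟ u)

swap-cycle : ∀ {m s} {p q : Fin m → Fin s} → Cycle q p → Cycle p q
swap-cycle C = record
  { half     = half C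
  ; a        = b C
  ; b        = λ i → a C (next i)
  ; fwd      = bwd C
  ; bwd      = λ i → fwd C (next i)
  ; a-inj    = b-inj C
  ; b-inj    = next-injective ∘ a-inj C
  ; fwd-inj  = bwd-inj C
  ; bwd-inj  = next-injective ∘ fwd-inj C
  ; fwd≢bwd  = λ i j eq → fwd≢bwd C (next j) i (sym eq)
  ; fwd-ends = bwd-ends C
  ; bwd-ends = λ i → fwd-ends C (next i)
  }

swap-cycle-edges : ∀ {m s} {p q : Fin m → Fin s} {S} (C : Cycle q p) →
                   EdgesIn S C → EdgesIn S (swap-cycle {p = p} C)
swap-cycle-edges C in-S (inj₁ (i , refl)) = in-S (inj₂ (i , refl))
swap-cycle-edges C in-S (inj₂ (i , refl)) = in-S (inj₁ (next i , refl))

-- Walks in the bipartite multigraph with an edge labelled u from p u to q u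

module BipartiteGraph {m s : ℕ} (p q : Fin m → Fin s) where

  Vertex : Set
  Vertex = Fin s ⊎ Fin s

  _≟ᵥ_ : DecidableEquality Vertex
  _≟ᵥ_ = ≡-dec Finₚ._≟_ Finₚ._≟_

  Incident : Fin m → Vertex → Set
  Incident u (inj₁ a) = p u ≡ a
  Incident u (inj₂ b) = q u ≡ b

  incident? : ∀ u α → Dec (Incident u α)
  incident? u (inj₁ a) = p u Finₚ.≟ a
  incident? u (inj₂ b) = q u Finₚ.≟ b

  star : Vertex → Fin m → Bool
  star α u = ⌊ incident? u α ⌋

  degree : (Fin m → Bool) → Vertex → ℕ
  degree S α = count (S ∩ star α)

  other : Fin m → Vertex → Vertex
  other u (inj₁ _) = inj₂ (q u)
  other u (inj₂ _) = inj₁ (p u)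

  incident-other : ∀ u α → Incident u (other u α)
  incident-other u (inj₁ _) = refl
  incident-other u (inj₂ _) = refl

  Joins : Fin m → Vertex → Vertex → Set
  Joins u (inj₁ a) (inj₂ b) = p u ≡ a × q u ≡ b
  Joins u (inj₂ b) (inj₁ a) = p u ≡ a × q u ≡ b
  Joins u _        _        = ⊥

  joins-sym : ∀ {u α β} → Joins u α β → Joins u β α
  joins-sym {α = inj₁ _} {inj₂ _} j = j
  joins-sym {α = inj₂ _} {inj₁ _} j = j

  joins-other : ∀ {u} α → Incident u α → Joins u α (other u α)
  joins-other (inj₁ _) refl = refl , refl
  joins-other (inj₂ _) refl = refl , refl

  joins-from-left : ∀ {u a β} → Joins u (inj₁ a) β → a ≡ p u × β ≡ inj₂ (q u)
  joins-from-left {β = inj₂ _} (refl , refl) = refl , refl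

  joins-from-right : ∀ {u b β} → Joins u (inj₂ b) β → b ≡ q u × β ≡ inj₁ (p u)
  joins-from-right {β = inj₁ _} (refl , refl) = refl , refl

  joins-determines-source : ∀ {u α β} → Joins u α β → α ≡ other u β
  joins-determines-source {α = inj₁ _} {inj₂ _} (refl , _) = refl
  joins-determines-source {α = inj₂ _} {inj₁ _} (_ , refl) = refl

  -- vertex and edge are total on ℕ; the walk itself is vertex 0, edge 0, …, edge (len − 1), vertex len.
  record Walk (S : Fin m → Bool) : Set where
    field
      len              : ℕ
      vertex           : ℕ → Vertex
      edge             : ℕ → Fin m
      joins            : ∀ {t} → t < len → Joins (edge t) (vertex t) (vertex (suc t))
      non-backtracking : ∀ {t} → suc t < len → edge t ≢ edge (suc t)
      edge∈            : ∀ {t} → t < len → edge t ∈ S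

  open Walk public

  Closed : ∀ {S} → Walk S → Set
  Closed W = 0 < len W × vertex W (len W) ≡ vertex W 0

  Simple : ∀ {S} → Walk S → Set
  Simple W = ∀ {i j} → i < len W → j < len W → vertex W i ≡ vertex W j → i ≡ j

  segment : ∀ {S} (W : Walk S) i l → i + l ≤ len W → Walk S
  segment W i l i+l≤len = record
    { len              = l
    ; vertex           = λ t → vertex W (i + t)
    ; edge             = λ t → edge W (i + t)
    ; joins            = λ {t} t<l →
        subst (Joins _ _) (cong (vertex W) (sym (+-suc i t))) (joins W (inside t<l))
    ; non-backtracking = λ {t} t+1<l →
        subst (λ j → edge W (i + t) ≢ edge W j) (sym (+-suc i t))
          (non-backtracking W (subst (_< len W) (+-suc i t) (inside t+1<l)))
    ; edge∈            = λ t<l → edge∈ W (inside t<l)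
    }
    where
    inside : ∀ {t} → t < l → i + t < len W
    inside t<l = <-≤-trans (+-monoʳ-< i t<l) i+l≤len

  reverse : ∀ {S} → Walk S → Walk S
  reverse W = record
    { len              = L
    ; vertex           = λ t → vertex W (L ∸ t)
    ; edge             = λ t → edge W (L ∸ suc t)
    ; joins            = λ {t} t<L →
        subst (λ i → Joins (edge W (L ∸ suc t)) (vertex W i) (vertex W (L ∸ suc t)))
              (sym (∸-suc t<L)) (joins-sym (joins W (mirror t<L)))
    ; non-backtracking = λ {t} t+1<L →
        subst (λ i → edge W i ≢ edge W (L ∸ suc (suc t))) (sym (∸-suc t+1<L))
              (≢-sym (non-backtracking W (subst (_< L) (∸-suc t+1<L) (mirror (≤-trans (n≤1+n _) t+1<L)))))
    ; edge∈            = λ t<L → edge∈ W (mirror t<L)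
    }
    where
    L = len W
    mirror : ∀ {t} → t < L → L ∸ suc t < L
    mirror t<L = ∸-monoʳ-< (s≤s z≤n) t<L

  module Append {S} (W₁ W₂ : Walk S) (meet : vertex W₁ (len W₁) ≡ vertex W₂ 0)
                (turn : ∀ {t} → suc t ≡ len W₁ → edge W₁ t ≢ edge W₂ 0) where

    L₁ = len W₁

    vertex′ : ℕ → Vertex
    vertex′ t with t ≤? L₁
    ... | yes _ = vertex W₁ t
    ... | no  _ = vertex W₂ (t ∸ L₁)

    edge′ : ℕ → Fin m
    edge′ t with t <? L₁
    ... | yes _ = edge W₁ t
    ... | no  _ = edge W₂ (t ∸ L₁)

    vertex-left : ∀ {t} → t ≤ L₁ → vertex′ t ≡ vertex W₁ t
    vertex-left {t} t≤L₁ with t ≤? L₁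
    ... | yes _   = refl
    ... | no  t≰L₁ = ⊥-elim (t≰L₁ t≤L₁)

    vertex-right : ∀ i → vertex′ (L₁ + i) ≡ vertex W₂ i
    vertex-right zero    = trans (vertex-left (≤-reflexive (+-identityʳ L₁)))
                                 (trans (cong (vertex W₁) (+-identityʳ L₁)) meet)
    vertex-right (suc i) with L₁ + suc i ≤? L₁
    ... | yes ≤L₁ = ⊥-elim (m+1+n≰m L₁ ≤L₁)
    ... | no  _   = cong (vertex W₂) (m+n∸m≡n L₁ (suc i))

    edge-left : ∀ {t} → t < L₁ → edge′ t ≡ edge W₁ t
    edge-left {t} t<L₁ with t <? L₁
    ... | yes _    = refl
    ... | no  t≮L₁ = ⊥-elim (t≮L₁ t<L₁)

    edge-right : ∀ i → edge′ (L₁ + i) ≡ edge W₂ i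
    edge-right i with L₁ + i <? L₁
    ... | yes <L₁ = ⊥-elim (m+n≮m L₁ i <L₁)
    ... | no  _   = cong (edge W₂) (m+n∸m≡n L₁ i)

    vertex-right-suc : ∀ i → vertex′ (suc (L₁ + i)) ≡ vertex W₂ (suc i)
    vertex-right-suc i = trans (cong vertex′ (sym (+-suc L₁ i))) (vertex-right (suc i))

    edge-right-suc : ∀ i → edge′ (suc (L₁ + i)) ≡ edge W₂ (suc i)
    edge-right-suc i = trans (cong edge′ (sym (+-suc L₁ i))) (edge-right (suc i))

    joins′ : ∀ {t} → t < L₁ + len W₂ → Joins (edge′ t) (vertex′ t) (vertex′ (suc t))
    joins′ {t} t<L with split-at L₁ t
    ... | inj₁ t<L₁
      rewrite edge-left t<L₁ | vertex-left (<⇒≤ t<L₁) | vertex-left t<L₁ = joins W₁ t<L₁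
    ... | inj₂ (i , refl)
      rewrite edge-right i | vertex-right i | vertex-right-suc i =
        joins W₂ (+-cancelˡ-< L₁ i _ t<L)

    non-backtracking′ : ∀ {t} → suc t < L₁ + len W₂ → edge′ t ≢ edge′ (suc t)
    non-backtracking′ {t} t+1<L with split-at L₁ t
    ... | inj₂ (i , refl) rewrite edge-right i | edge-right-suc i =
      non-backtracking W₂ (+-cancelˡ-< L₁ (suc i) _
        (subst (_< L₁ + len W₂) (sym (+-suc L₁ i)) t+1<L))
    ... | inj₁ t<L₁ with m≤n⇒m<n∨m≡n t<L₁
    ...   | inj₁ t+1<L₁ rewrite edge-left t<L₁ | edge-left t+1<L₁ = non-backtracking W₁ t+1<L₁
    ...   | inj₂ t+1≡L₁ = λ same → turn t+1≡L₁ (begin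
      edge W₁ t          ≡⟨ edge-left t<L₁ ⟨
      edge′ t            ≡⟨ same ⟩
      edge′ (suc t)      ≡⟨ cong edge′ (trans t+1≡L₁ (sym (+-identityʳ L₁))) ⟩
      edge′ (L₁ + 0)     ≡⟨ edge-right 0 ⟩
      edge W₂ 0          ∎)
      where open ≡-Reasoning

    edge′∈ : ∀ {t} → t < L₁ + len W₂ → edge′ t ∈ S
    edge′∈ {t} t<L with split-at L₁ t
    ... | inj₁ t<L₁       rewrite edge-left t<L₁ = edge∈ W₁ t<L₁
    ... | inj₂ (i , refl) rewrite edge-right i   = edge∈ W₂ (+-cancelˡ-< L₁ i _ t<L)

    walk : Walk S
    walk = record
      { len = L₁ + len W₂ ; vertex = vertex′ ; edge = edge′
      ; joins = joins′ ; non-backtracking = non-backtracking′ ; edge∈ = edge′∈ }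

  close-up : ∀ {S} (W₁ W₂ : Walk S) → vertex W₁ 0 ≡ vertex W₂ 0 →
             ∀ {i} → i < len W₁ → i < len W₂ →
             vertex W₁ (suc i) ≡ vertex W₂ (suc i) → edge W₁ i ≢ edge W₂ i →
             Σ (Walk S) λ W → Closed W × len W ≡ suc i + suc i
  close-up W₁ W₂ start {i} i<L₁ i<L₂ meet differ =
    walk , (s≤s z≤n , end-is-start) , refl
    where
    out  = segment W₁ 0 (suc i) i<L₁
    back = reverse (segment W₂ 0 (suc i) i<L₂)
    turn : ∀ {t} → suc t ≡ suc i → edge W₁ t ≢ edge W₂ i
    turn t+1≡ = subst (λ t → edge W₁ t ≢ edge W₂ i) (sym (suc-injective t+1≡)) differ
    open Append out back meet turn
    end-is-start : vertex′ (suc i + suc i) ≡ vertex′ 0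
    end-is-start = begin
      vertex′ (suc i + suc i)          ≡⟨ vertex-right (suc i) ⟩
      vertex W₂ (suc i ∸ suc i)        ≡⟨ cong (vertex W₂) (n∸n≡0 i) ⟩
      vertex W₂ 0                      ≡⟨ sym start ⟩
      vertex W₁ 0                      ≡⟨ sym (vertex-left z≤n) ⟩
      vertex′ 0                        ∎
      where open ≡-Reasoning

  loop-segment : ∀ {S} (W : Walk S) {i j} → i < j → j < len W → vertex W i ≡ vertex W j →
                 Σ (Walk S) λ W′ → Closed W′ × len W′ < len W
  loop-segment W {i} {j} i<j j<L vi≡vj =
    segment W i (j ∸ i) (≤-trans (≤-reflexive i+[j∸i]≡j) (<⇒≤ j<L)) ,
    (m<n⇒0<n∸m i<j , returns) ,
    ≤-<-trans (m∸n≤m j i) j<L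
    where
    i+[j∸i]≡j : i + (j ∸ i) ≡ j
    i+[j∸i]≡j = m+[n∸m]≡n (<⇒≤ i<j)
    returns : vertex W (i + (j ∸ i)) ≡ vertex W (i + 0)
    returns = trans (cong (vertex W) i+[j∸i]≡j) (trans (sym vi≡vj) (cong (vertex W) (sym (+-identityʳ i))))

  repetition-or-simple : ∀ {S} (W : Walk S) →
    (∃ λ j → j < len W × ∃ λ i → i < j × vertex W i ≡ vertex W j) ⊎ Simple W
  repetition-or-simple W with anyUpTo? (λ j → anyUpTo? (λ i → vertex W i ≟ᵥ vertex W j) j) (len W)
  ... | yes repetition = inj₁ repetition
  ... | no  none       = inj₂ simple
    where
    simple : Simple W
    simple {i} {j} i<L j<L vi≡vj with <-cmp i j
    ... | tri< i<j _ _ = ⊥-elim (none (j , j<L , i , i<j , vi≡vj))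
    ... | tri≈ _ i≡j _ = i≡j
    ... | tri> _ _ j<i = ⊥-elim (none (i , i<L , j , j<i , sym vi≡vj))

  simple-closed-subwalk : ∀ {S} (W : Walk S) → Closed W →
                          Σ (Walk S) λ W′ → Closed W′ × Simple W′ × len W′ ≤ len W
  simple-closed-subwalk W = shorten (len W) W ≤-refl
    where
    shorten : ∀ {S} n (W : Walk S) → len W ≤ n → Closed W →
              Σ (Walk S) λ W′ → Closed W′ × Simple W′ × len W′ ≤ len W
    shorten zero    W L≤0 closed = ⊥-elim (n≮0 (<-≤-trans (proj₁ closed) L≤0))
    shorten (suc n) W L≤n closed with repetition-or-simple W
    ... | inj₂ simple = W , closed , simple , ≤-refl
    ... | inj₁ (j , j<L , i , i<j , vi≡vj) with loop-segment W i<j j<L vi≡vj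
    ...   | W′ , closed′ , shorter with shorten n W′ (s≤s⁻¹ (<-≤-trans shorter L≤n)) closed′
    ...     | W″ , closed″ , simple″ , L″≤L′ =
      W″ , closed″ , simple″ , ≤-trans L″≤L′ (<⇒≤ shorter)

  joins-from : ∀ {S} (W : Walk S) {t α} → t < len W → vertex W t ≡ α →
               Joins (edge W t) α (vertex W (suc t))
  joins-from W t<L refl = joins W t<L

  module ReadCycle {S} (W : Walk S) (closed : Closed W) (simple : Simple W)
                     {a₀} (starts-left : vertex W 0 ≡ inj₁ a₀) where

    L = len W

    alternates : ∀ t → suc (2 * t) ≤ L →
                 vertex W (2 * t) ≡ inj₁ (p (edge W (2 * t))) ×
                 vertex W (suc (2 * t)) ≡ inj₂ (q (edge W (2 * t)))
    alternates zero 0<L with joins-from-left (joins-from W 0<L starts-left)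
    ... | a₀≡ , v₁≡ = trans starts-left (cong inj₁ a₀≡) , v₁≡
    alternates (suc t) 2t+3≤L rewrite *-suc 2 t
      with joins-from-right (joins-from W (<⇒≤ 2t+3≤L)
                              (proj₂ (alternates t (≤-trans (n≤1+n _) (<⇒≤ 2t+3≤L)))))
    ... | _ , v₂≡ with joins-from-left (joins-from W 2t+3≤L v₂≡)
    ...   | p≡ , v₃≡ = trans v₂≡ (cong inj₁ p≡) , v₃≡

    even-length : ∃ λ h → L ≡ 2 * suc h
    even-length with parity L
    ... | inj₁ (suc h , L≡) = h , L≡
    ... | inj₁ (zero  , L≡) = ⊥-elim (<-irrefl (sym L≡) (proj₁ closed))
    ... | inj₂ (t , L≡) = ⊥-elim (inj₂≢inj₁ (begin
      inj₂ _                  ≡⟨ proj₂ (alternates t (≤-reflexive (sym L≡))) ⟨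
      vertex W (suc (2 * t))  ≡⟨ cong (vertex W) L≡ ⟨
      vertex W L              ≡⟨ proj₂ closed ⟩
      vertex W 0              ≡⟨ starts-left ⟩
      inj₁ a₀                 ∎))
      where
      open ≡-Reasoning
      inj₂≢inj₁ : ∀ {b a : Fin s} → inj₂ b ≢ inj₁ a
      inj₂≢inj₁ ()

    module WithHalf (h : ℕ) (L≡ : L ≡ 2 * suc h) where

      odd< : ∀ (i : Fin (suc h)) → suc (2 * toℕ i) < L
      odd< i = subst (suc (2 * toℕ i) <_) (sym (trans L≡ (*-suc 2 h)))
                 (s≤s (s≤s (*-monoʳ-≤ 2 (Finₚ.toℕ≤pred[n] i))))

      even< : ∀ (i : Fin (suc h)) → 2 * toℕ i < L
      even< i = <-trans (n<1+n _) (odd< i)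

      -- Position 2i of the walk is the left vertex a i, position 2i + 1 the right vertex b i.
      fwd′ bwd′ : Fin (suc h) → Fin m
      fwd′ i = edge W (2 * toℕ i)
      bwd′ i = edge W (suc (2 * toℕ i))

      at-fwd : ∀ i → vertex W (2 * toℕ i) ≡ inj₁ (p (fwd′ i)) ×
                     vertex W (suc (2 * toℕ i)) ≡ inj₂ (q (fwd′ i))
      at-fwd i = alternates (toℕ i) (<⇒≤ (odd< i))

      at-bwd : ∀ i → q (fwd′ i) ≡ q (bwd′ i) ×
                     vertex W (suc (suc (2 * toℕ i))) ≡ inj₁ (p (bwd′ i))
      at-bwd i = joins-from-right (joins-from W (odd< i) (proj₂ (at-fwd i)))

      wraps : ∀ i → vertex W (suc (suc (2 * toℕ i))) ≡ vertex W (2 * toℕ (next i))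
      wraps i with next-cases i
      ... | inj₁ (_ , next≡) = cong (vertex W) (trans (sym (*-suc 2 (toℕ i))) (cong (2 *_) (sym next≡)))
      ... | inj₂ (i≡h , next≡) = begin
        vertex W (suc (suc (2 * toℕ i)))   ≡⟨ cong (vertex W) (*-suc 2 (toℕ i)) ⟨
        vertex W (2 * suc (toℕ i))         ≡⟨ cong (λ j → vertex W (2 * suc j)) i≡h ⟩
        vertex W (2 * suc h)               ≡⟨ cong (vertex W) (sym L≡) ⟩
        vertex W L                         ≡⟨ proj₂ closed ⟩
        vertex W 0                         ≡⟨ cong (λ j → vertex W (2 * j)) (sym next≡) ⟩
        vertex W (2 * toℕ (next i))        ∎
        where open ≡-Reasoning

      left-injective : ∀ {i j} → p (fwd′ i) ≡ p (fwd′ j) → i ≡ j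
      left-injective {i} {j} eq = Finₚ.toℕ-injective (*-cancelˡ-≡ _ _ 2 (simple (even< i) (even< j)
        (trans (proj₁ (at-fwd i)) (trans (cong inj₁ eq) (sym (proj₁ (at-fwd j)))))))

      right-injective : ∀ {i j} → q (fwd′ i) ≡ q (fwd′ j) → i ≡ j
      right-injective {i} {j} eq = Finₚ.toℕ-injective (*-cancelˡ-≡ _ _ 2 (suc-injective
        (simple (odd< i) (odd< j) (trans (proj₂ (at-fwd i)) (trans (cong inj₂ eq) (sym (proj₂ (at-fwd j))))))))

      bwd-right : ∀ {i j} → q (bwd′ i) ≡ q (fwd′ j) → i ≡ j
      bwd-right {i} {j} eq = right-injective {i} {j} (trans (proj₁ (at-bwd i)) eq)

      cycle : Cycle p q
      cycle = record
        { half     = h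
        ; a        = λ i → p (fwd′ i)
        ; b        = λ i → q (fwd′ i)
        ; fwd      = fwd′
        ; bwd      = bwd′
        ; a-inj    = λ {i} {j} → left-injective {i} {j}
        ; b-inj    = λ {i} {j} → right-injective {i} {j}
        ; fwd-inj  = λ {i} {j} eq → left-injective {i} {j} (cong p eq)
        ; bwd-inj  = λ {i} {j} eq → bwd-right {i} {j} (trans (cong q eq) (sym (proj₁ (at-bwd j))))
        ; fwd≢bwd  = λ i j eq → non-backtracking W (odd< i)
                       (trans eq (cong bwd′ (bwd-right {j} {i} (cong q (sym eq)))))
        ; fwd-ends = λ i → refl , refl
        ; bwd-ends = λ i → sym (proj₁ (at-bwd i)) ,
                           inj₁-injective (trans (sym (proj₂ (at-bwd i)))
                                                 (trans (wraps i) (proj₁ (at-fwd (next i)))))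
        }

      cycle-edges : EdgesIn S cycle
      cycle-edges (inj₁ (i , refl)) = edge∈ W (even< i)
      cycle-edges (inj₂ (i , refl)) = edge∈ W (odd< i)

    cycle-of-simple-walk : Σ (Cycle p q) λ C → EdgesIn S C × length C ≡ len W
    cycle-of-simple-walk with even-length
    ... | h , L≡ = WithHalf.cycle h L≡ , WithHalf.cycle-edges h L≡ , sym L≡

  last-divergence : ∀ {S} (W₁ W₂ : Walk S) {j} → j ≤ len W₁ → j ≤ len W₂ →
                    vertex W₁ j ≡ vertex W₂ j → ¬ (∀ {t} → t < j → edge W₁ t ≡ edge W₂ t) →
                    ∃ λ i → i < j × vertex W₁ (suc i) ≡ vertex W₂ (suc i) × edge W₁ i ≢ edge W₂ i
  last-divergence W₁ W₂ {zero}  _     _     _    differ = ⊥-elim (differ λ ())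
  last-divergence W₁ W₂ {suc i} i<L₁ i<L₂ meet differ with edge W₁ i Finₚ.≟ edge W₂ i
  ... | no  ne   = i , ≤-refl , meet , ne
  ... | yes same with last-divergence W₁ W₂ (<⇒≤ i<L₁) (<⇒≤ i<L₂) meet-earlier (differ ∘ extend)
    where
    meet-earlier : vertex W₁ i ≡ vertex W₂ i
    meet-earlier = begin
      vertex W₁ i                            ≡⟨ joins-determines-source (joins W₁ i<L₁) ⟩
      other (edge W₁ i) (vertex W₁ (suc i))  ≡⟨ cong₂ other same meet ⟩
      other (edge W₂ i) (vertex W₂ (suc i))  ≡⟨ joins-determines-source (joins W₂ i<L₂) ⟨
      vertex W₂ i                            ∎
      where open ≡-Reasoning
    extend : (∀ {t} → t < i → edge W₁ t ≡ edge W₂ t) → ∀ {t} → t < suc i → edge W₁ t ≡ edge W₂ t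
    extend agree t<i+1 with m<1+n⇒m<n∨m≡n t<i+1
    ... | inj₁ t<i  = agree t<i
    ... | inj₂ refl = same
  ... | i′ , i′<i , meet′ , ne = i′ , m<n⇒m<1+n i′<i , meet′ , ne

  degree-mono : ∀ {S R} α → S ⊆ R → degree S α ≤ degree R α
  degree-mono {S} {R} α S⊆R = count-mono {S = S ∩ star α} {R ∩ star α} λ u∈ →
    let u∈S , u∈α = ∈-∩⁻ {S = S} {star α} u∈ in ∈-∩ {S = R} {star α} (S⊆R u∈S) u∈α

  degree-split : ∀ S α → count S ≡ degree S α + count (S ─ star α)
  degree-split S α = count-split S (star α)

  degree-removed : ∀ S α → degree (S ─ star α) α ≡ 0
  degree-removed S α = count-empty ((S ─ star α) ∩ star α) λ u u∈ →
    let u∈S─α , u∈α = ∈-∩⁻ {S = S ─ star α} {star α} u∈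
    in  proj₂ (∈-─⁻ {S = S} {star α} u∈S─α) u∈α

  incident⇒degree-pos : ∀ {S u} α → u ∈ S → Incident u α → 0 < degree S α
  incident⇒degree-pos {S} α u∈S inc =
    ∈⇒0<count {S = S ∩ star α} (∈-∩ {S = S} {star α} u∈S (fromWitness inc))

  countᵥ : (Vertex → Bool) → ℕ
  countᵥ P = count (P ∘ splitAt s)

  countᵥ-mono-< : ∀ {P Q : Vertex → Bool} {α} → (∀ {β} → T (P β) → T (Q β)) → T (Q α) → ¬ T (P α) →
                  countᵥ P < countᵥ Q
  countᵥ-mono-< {P} {Q} {α} P⊆Q α∈Q α∉P =
    count-mono-< {S = P ∘ splitAt s} {Q ∘ splitAt s} {join s s α} P⊆Q
      (subst (T ∘ Q) (sym (Finₚ.splitAt-join s s α)) α∈Q)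
      (α∉P ∘ subst (T ∘ P) (Finₚ.splitAt-join s s α))

  non-isolated : (Fin m → Bool) → ℕ
  non-isolated S = countᵥ (λ α → 0 <ᵇ degree S α)

  non-isolated≤ : ∀ S → non-isolated S ≤ s + s
  non-isolated≤ S = count≤n _

  non-isolated-removed : ∀ S α → 0 < degree S α → non-isolated (S ─ star α) < non-isolated S
  non-isolated-removed S α pos =
    countᵥ-mono-< {λ β → 0 <ᵇ degree (S ─ star α) β} {λ β → 0 <ᵇ degree S β} {α}
    (λ {β} → <⇒<ᵇ ∘ flip <-≤-trans (degree-mono β (─-⊆ S (star α))) ∘ <ᵇ⇒< 0 _)
    (<⇒<ᵇ pos)
    (λ pos′ → <-irrefl (sym (degree-removed S α)) (<ᵇ⇒< 0 _ pos′))

  MinDegree : (Fin m → Bool) → ℕ → Set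
  MinDegree S d = ∀ {u} α → u ∈ S → Incident u α → d < degree S α

  any-vertex? : {P : Vertex → Set} → (∀ α → Dec (P α)) → Dec (∃ P)
  any-vertex? P? with Finₚ.any? (P? ∘ inj₁) | Finₚ.any? (P? ∘ inj₂)
  ... | yes (a , Pa) | _            = yes (inj₁ a , Pa)
  ... | no  _        | yes (b , Pb) = yes (inj₂ b , Pb)
  ... | no  ¬A       | no  ¬B       = no λ { (inj₁ a , Pa) → ¬A (a , Pa) ; (inj₂ b , Pb) → ¬B (b , Pb) }

  peel-vertex : ∀ {d} S α → 0 < degree S α → degree S α ≤ d → d * non-isolated S < count S →
                count (S ─ star α) < count S × d * non-isolated (S ─ star α) < count (S ─ star α)
  peel-vertex {d} S α pos small dense = fewer , dense′
    where
    open ≤-Reasoning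
    S′ = S ─ star α
    fewer : count S′ < count S
    fewer = begin-strict
      count S′               <⟨ +-monoˡ-≤ (count S′) pos ⟩
      degree S α + count S′  ≡⟨ degree-split S α ⟨
      count S                ∎
    dense′ : d * non-isolated S′ < count S′
    dense′ = +-cancelˡ-< d _ _ (begin-strict
      d + d * non-isolated S′     ≡⟨ *-suc d _ ⟨
      d * suc (non-isolated S′)   ≤⟨ *-monoʳ-≤ d (non-isolated-removed S α pos) ⟩
      d * non-isolated S          <⟨ dense ⟩
      count S                     ≡⟨ degree-split S α ⟩
      degree S α + count S′       ≤⟨ +-monoˡ-≤ _ small ⟩
      d + count S′                ∎)

  dense-core : ∀ d S → d * non-isolated S < count S →
               Σ (Fin m → Bool) λ S′ → S′ ⊆ S × d * non-isolated S′ < count S′ × MinDegree S′ d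
  dense-core d S = peel (count S) S ≤-refl
    where
    peel : ∀ fuel S → count S ≤ fuel → d * non-isolated S < count S →
           Σ (Fin m → Bool) λ S′ → S′ ⊆ S × d * non-isolated S′ < count S′ × MinDegree S′ d
    peel zero       S S≤0    dense = ⊥-elim (n≮0 (<-≤-trans dense S≤0))
    peel (suc fuel) S S≤fuel dense with any-vertex? (λ α → 0 <? degree S α ×-dec degree S α ≤? d)
    ... | no none = S , id , dense , λ α u∈S inc →
          ≰⇒> λ small → none (α , incident⇒degree-pos α u∈S inc , small)
    ... | yes (α , pos , small) with peel-vertex S α pos small dense
    ...   | fewer , dense′ with peel fuel (S ─ star α) (s≤s⁻¹ (<-≤-trans fewer S≤fuel)) dense′
    ...     | S″ , S″⊆S′ , dense″ , min-degree =
      S″ , ─-⊆ S (star α) ∘ S″⊆S′ , dense″ , min-degree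

  module NonBacktracking (S : Fin m → Bool) (d : ℕ) (min-degree : MinDegree S d) where

    record Dart : Set where
      constructor dart
      field
        head  : Vertex
        via   : Fin m
        via∈S : via ∈ S
        lands : Incident via head

    open Dart

    exits : Dart → Fin m → Bool
    exits δ = S ∩ star (head δ) ─ ⁅ via δ ⁆

    many-exits : ∀ δ → d ≤ count (exits δ)
    many-exits δ = s≤s⁻¹ (<-≤-trans (min-degree (head δ) (via∈S δ) (lands δ))
                                    (count-remove-one (S ∩ star (head δ)) (via δ)))

    exit : Dart → Fin d → Fin m
    exit δ = proj₁ (distinct-members (exits δ) (many-exits δ))

    exit-injective : ∀ δ → Injective _≡_ _≡_ (exit δ)
    exit-injective δ = proj₁ (proj₂ (distinct-members (exits δ) (many-exits δ)))

    exit∈exits : ∀ δ c → exit δ c ∈ exits δ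
    exit∈exits δ = proj₂ (proj₂ (distinct-members (exits δ) (many-exits δ)))

    exit-spec : ∀ δ c → exit δ c ∈ S × Incident (exit δ c) (head δ) × exit δ c ≢ via δ
    exit-spec δ c =
      let u∈S∩α , u∉via = ∈-─⁻ {S = S ∩ star (head δ)} {⁅ via δ ⁆} (exit∈exits δ c)
          u∈S , u∈α     = ∈-∩⁻ {S = S} {star (head δ)} u∈S∩α
      in  u∈S , toWitness u∈α , u∉via ∘ fromWitness

    step : Dart → Fin d → Dart
    step δ c = dart (other u (head δ)) u (proj₁ (exit-spec δ c)) (incident-other u (head δ))
      where u = exit δ c

    darts : ∀ {k} → Dart → (Fin k → Fin d) → ℕ → Dart
    darts         δ c zero    = δ
    darts {zero}  δ c (suc t) = δ
    darts {suc k} δ c (suc t) = darts (step δ (c zero)) (c ∘ suc) t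

    darts-step : ∀ {k} δ (c : Fin k → Fin d) {t} → t < k →
                 ∃ λ c′ → darts δ c (suc t) ≡ step (darts δ c t) c′
    darts-step {suc k} δ c {zero}  _         = c zero , refl
    darts-step {suc k} δ c {suc t} (s≤s t<k) = darts-step (step δ (c zero)) (c ∘ suc) t<k

    walk : ∀ {k} → Dart → (Fin k → Fin d) → Walk S
    walk {k} δ c = record
      { len              = k
      ; vertex           = λ t → head (darts δ c t)
      ; edge             = λ t → via (darts δ c (suc t))
      ; joins            = joins′
      ; non-backtracking = non-backtracking′
      ; edge∈            = λ {t} _ → via∈S (darts δ c (suc t))
      }
      where
      joins′ : ∀ {t} → t < k →
               Joins (via (darts δ c (suc t))) (head (darts δ c t)) (head (darts δ c (suc t)))
      joins′ {t} t<k with darts-step δ c t<k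
      ... | c′ , eq rewrite eq = joins-other _ (proj₁ (proj₂ (exit-spec (darts δ c t) c′)))
      non-backtracking′ : ∀ {t} → suc t < k → via (darts δ c (suc t)) ≢ via (darts δ c (suc (suc t)))
      non-backtracking′ {t} t+1<k with darts-step δ c t+1<k
      ... | c′ , eq rewrite eq = ≢-sym (proj₂ (proj₂ (exit-spec (darts δ c (suc t)) c′)))

    walk-determines-choices : ∀ {k} δ (c c′ : Fin k → Fin d) →
      (∀ {t} → t < k → edge (walk δ c) t ≡ edge (walk δ c′) t) → c ≗ c′
    walk-determines-choices {suc k} δ c c′ same = λ
      { zero    → c₀≡
      ; (suc i) → walk-determines-choices (step δ (c zero)) (c ∘ suc) (c′ ∘ suc) same-tail i
      }
      where
      c₀≡ : c zero ≡ c′ zero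
      c₀≡ = exit-injective δ (same (s≤s z≤n))
      δ₁ = step δ (c zero)
      same-tail : ∀ {t} → t < k → edge (walk δ₁ (c ∘ suc)) t ≡ edge (walk δ₁ (c′ ∘ suc)) t
      same-tail {t} t<k =
        trans (same (s≤s t<k)) (cong (λ x → via (darts (step δ x) (c′ ∘ suc) (suc t))) (sym c₀≡))

-- Short cycles in large sets of labels

module _ {m s : ℕ} {p q : Fin m → Fin s} where
  private
    module G = BipartiteGraph p q
    module H = BipartiteGraph q p

  swap-joins : ∀ {u} α β → G.Joins u α β → H.Joins u (Sum.swap α) (Sum.swap β)
  swap-joins (inj₁ _) (inj₂ _) = Product.swap
  swap-joins (inj₂ _) (inj₁ _) = Product.swap

  swap-walk : ∀ {S} → G.Walk S → H.Walk S
  swap-walk W = record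
    { len              = G.len W
    ; vertex           = Sum.swap ∘ G.vertex W
    ; edge             = G.edge W
    ; joins            = λ t<L → swap-joins _ _ (G.joins W t<L)
    ; non-backtracking = G.non-backtracking W
    ; edge∈            = G.edge∈ W
    }

  swap-closed : ∀ {S} (W : G.Walk S) → G.Closed W → H.Closed (swap-walk W)
  swap-closed W (0<L , closed) = 0<L , cong Sum.swap closed

  swap-simple : ∀ {S} (W : G.Walk S) → G.Simple W → H.Simple (swap-walk W)
  swap-simple W simple i<L j<L eq = simple i<L j<L (swap-injective eq)

  cycle-of-closed-walk : ∀ {S} (W : G.Walk S) → G.Closed W →
                         Σ (Cycle p q) λ C → EdgesIn S C × length C ≤ G.len W
  cycle-of-closed-walk W closed with G.simple-closed-subwalk W closed
  ... | W′ , closed′ , simple′ , L′≤L with side (G.vertex W′ 0)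
  ...   | inj₁ (_ , v₀≡) with G.ReadCycle.cycle-of-simple-walk W′ closed′ simple′ v₀≡
  ...     | C , in-S , length≡ = C , in-S , ≤-trans (≤-reflexive length≡) L′≤L
  -- A walk starting on the right side is read as a walk of the mirrored graph G(q, p).
  cycle-of-closed-walk W closed | W′ , closed′ , simple′ , L′≤L | inj₂ (_ , v₀≡)
    with H.ReadCycle.cycle-of-simple-walk (swap-walk W′) (swap-closed W′ closed′) (swap-simple W′ simple′)
                                          (cong Sum.swap v₀≡)
  ...     | C , in-S , length≡ =
    swap-cycle C , swap-cycle-edges C in-S , ≤-trans (≤-reflexive length≡) L′≤L

  short-cycle-of-min-degree : ∀ {S d k} → G.MinDegree S d → s + s < d ^ k → ∃ (λ u → u ∈ S) →
                              Σ (Cycle p q) λ C → EdgesIn S C × length C ≤ 2 * k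
  short-cycle-of-min-degree {S} {d} {k} min-degree s+s<dᵏ (u , u∈S) =
    let i , j , i<j , same-end = Finₚ.pigeonhole s+s<dᵏ (endpoint ∘ route)
        t , t<k , meet , differ = G.last-divergence (route i) (route j) ≤-refl ≤-refl
                                    (join-injective s s same-end) (routes-differ i<j)
        W , closed , len≡ = G.close-up (route i) (route j) refl t<k t<k meet differ
        C , in-S , C≤W = cycle-of-closed-walk W closed
    in C , in-S , (begin
      length C          ≤⟨ C≤W ⟩
      G.len W           ≡⟨ len≡ ⟩
      suc t + suc t     ≤⟨ +-mono-≤ t<k t<k ⟩
      k + k             ≡⟨ cong (k +_) (+-identityʳ k) ⟨
      2 * k             ∎)
    where
    open G.NonBacktracking S d min-degree
    open ≤-Reasoning
    origin : Dart
    origin = dart (inj₁ (p u)) u u∈S refl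
    route : Fin (d ^ k) → G.Walk S
    route i = walk origin (finToFun {d} {k} i)
    endpoint : G.Walk S → Fin (s + s)
    endpoint W = join s s (G.vertex W k)
    routes-differ : ∀ {i j} → toℕ i < toℕ j → ¬ (∀ {t} → t < k → G.edge (route i) t ≡ G.edge (route j) t)
    routes-differ {i} {j} i<j same = <-irrefl (cong toℕ (finToFun-injective {d} {k}
      (walk-determines-choices origin (finToFun {d} {k} i) (finToFun {d} {k} j) same))) i<j

  short-cycle : ∀ {S d k} → s + s < d ^ k → d * (s + s) < count S →
                Σ (Cycle p q) λ C → EdgesIn S C × length C ≤ 2 * k
  short-cycle {S} {d} {k} s+s<dᵏ large =
    let S′ , S′⊆S , dense , min-degree =
          G.dense-core d S (≤-<-trans (*-monoʳ-≤ d (G.non-isolated≤ S)) large)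
        C , in-S′ , short =
          short-cycle-of-min-degree {k = k} min-degree s+s<dᵏ (0<count⇒∃∈ S′ (≤-<-trans z≤n dense))
    in  C , S′⊆S ∘ in-S′ , short

  labels : Cycle p q → Fin m → Bool
  labels C u = ⌊ hasLabel? C u ⌋

  short-cycle-cover : ∀ {d k} → s + s < d ^ k →
    Σ (Fin m → Bool) λ S → count S ≤ d * (s + s) ×
      ∀ {u} → u ∉ S → Σ (Cycle p q) λ C → length C ≤ 2 * k × HasLabel C u
  short-cycle-cover {d} {k} s+s<dᵏ = shrink m (λ _ → true) (count≤n _) (λ u∉ → ⊥-elim (u∉ _))
    where
    Covered : (Fin m → Bool) → Set
    Covered S = ∀ {u} → u ∉ S → Σ (Cycle p q) λ C → length C ≤ 2 * k × HasLabel C u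

    remove-cycle : ∀ {S} (C : Cycle p q) → EdgesIn S C → length C ≤ 2 * k → Covered S →
                   count (S ─ labels C) < count S × Covered (S ─ labels C)
    remove-cycle {S} C in-S short covered = fewer , covered′
      where
      first-edge : HasLabel C (fwd C zero)
      first-edge = inj₁ (zero , refl)
      fewer : count (S ─ labels C) < count S
      fewer = count-mono-< {S = S ─ labels C} {S} (─-⊆ S (labels C)) (in-S first-edge)
                (λ e∈ → proj₂ (∈-─⁻ {S = S} {labels C} e∈) (fromWitness first-edge))
      covered′ : Covered (S ─ labels C)
      covered′ u∉ with ∉-─ {S = S} {labels C} u∉
      ... | inj₁ u∉S = covered u∉S
      ... | inj₂ u∈C = C , short , toWitness u∈C

    shrink : ∀ fuel S → count S ≤ fuel → Covered S →
             Σ (Fin m → Bool) λ S → count S ≤ d * (s + s) × Covered S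
    shrink zero S S≤0 covered = S , ≤-trans S≤0 z≤n , covered
    shrink (suc fuel) S S≤fuel covered with d * (s + s) <? count S
    ... | no  small = S , ≮⇒≥ small , covered
    ... | yes large =
      let C , in-S , short = short-cycle {S = S} {d} {k} s+s<dᵏ large
          fewer , covered′ = remove-cycle C in-S short covered
      in shrink fuel (S ─ labels C) (s≤s⁻¹ (<-≤-trans fewer S≤fuel)) covered′

shared-short-cycles : ∀ {m s d k} (x y z : Fin m → Fin s) →
  s + s < d ^ k → d * (s + s) + d * (s + s) < m →
  Σ (Cycle x y) λ C₁ → Σ (Cycle y z) λ C₂ →
    length C₁ ≤ 2 * k × length C₂ ≤ 2 * k × ∃ λ u → HasLabel C₁ u × HasLabel C₂ u
shared-short-cycles {m} {s} {d} {k} x y z s+s<dᵏ fits =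
  use-cover (short-cycle-cover {p = x} {y} {d} {k} s+s<dᵏ)
  where
  Goal : Set
  Goal = Σ (Cycle x y) λ C₁ → Σ (Cycle y z) λ C₂ →
           length C₁ ≤ 2 * k × length C₂ ≤ 2 * k × ∃ λ u → HasLabel C₁ u × HasLabel C₂ u
  use-cover : (Σ (Fin m → Bool) λ S → count S ≤ d * (s + s) ×
                 ∀ {u} → u ∉ S → Σ (Cycle x y) λ C → length C ≤ 2 * k × HasLabel C u) → Goal
  use-cover (S₁ , small , covered) =
    use-cycle (short-cycle {p = y} {z} {∁ S₁} {d} {k} s+s<dᵏ (count-∁-large S₁ fits small))
    where
    use-cycle : (Σ (Cycle y z) λ C → EdgesIn (∁ S₁) C × length C ≤ 2 * k) → Goal
    use-cycle (C₂ , in-∁S₁ , short₂) =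
      let C₁ , short₁ , shared = covered (∈-∁ {S = S₁} (in-∁S₁ (inj₁ (zero , refl))))
      in C₁ , C₂ , short₁ , short₂ , fwd C₂ zero , shared , inj₁ (zero , refl)

-- Choice of the parameters

^-distribʳ-* : ∀ a b k → (a * b) ^ k ≡ a ^ k * b ^ k
^-distribʳ-* a b zero    = refl
^-distribʳ-* a b (suc k) =
  trans (cong (a * b *_) (^-distribʳ-* a b k)) (interchange a b (a ^ k) (b ^ k))
  where
  interchange : ∀ a b x y → a * b * (x * y) ≡ a * x * (b * y)
  interchange = solve-∀

power-bound : ∀ {M s} k D → M ≤ D * (8 * s) → D ^ k ≤ s + s → M ^ k ≤ (600 * s) ^ suc k
power-bound {M} {s} k D M≤ Dᵏ≤ = begin
  M ^ k                      ≤⟨ ^-monoˡ-≤ k M≤ ⟩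
  (D * (8 * s)) ^ k          ≡⟨ ^-distribʳ-* D (8 * s) k ⟩
  D ^ k * (8 * s) ^ k        ≤⟨ *-mono-≤ Dᵏ≤ (^-monoˡ-≤ k (*-monoˡ-≤ s (m≤m+n 8 592))) ⟩
  (s + s) * (600 * s) ^ k    ≤⟨ *-monoˡ-≤ _ s+s≤600s ⟩
  600 * s * (600 * s) ^ k    ∎
  where
  open ≤-Reasoning
  s+s≤600s : s + s ≤ 600 * s
  s+s≤600s = ≤-trans (≤-reflexive (cong (s +_) (sym (+-identityʳ s)))) (*-monoˡ-≤ s (m≤m+n 2 598))

-- If dᵏ ≤ 2s then m ≤ max(d, 1)·8s, whence mᵏ ≤ 2s·(8s)ᵏ ≤ (600s)ᵏ⁺¹.
branching-large : ∀ m′ s′ k → (600 * suc s′) ^ suc k < suc m′ ^ k →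
                  suc s′ + suc s′ < (m′ / (4 * suc s′)) ^ k
branching-large m′ s′ k hyp with suc s′ + suc s′ <? (m′ / (4 * suc s′)) ^ k
... | yes large = large
... | no  small = ⊥-elim (<⇒≱ hyp (few-branches (m′ / n) refl (≮⇒≥ small)))
  where
  s = suc s′
  n = 4 * s
  m′<[1+d]n : m′ < suc (m′ / n) * n
  m′<[1+d]n = begin-strict
    m′                       ≡⟨ m≡m%n+[m/n]*n m′ n ⟩
    m′ % n + (m′ / n) * n    <⟨ +-monoˡ-< _ (m%n<n m′ n) ⟩
    n + (m′ / n) * n         ∎
    where open ≤-Reasoning
  few-branches : ∀ d → d ≡ m′ / n → d ^ k ≤ s + s → suc m′ ^ k ≤ (600 * s) ^ suc k
  few-branches zero d≡ _ = power-bound {s = s} k 1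
    (≤-trans (subst (λ d → suc m′ ≤ suc d * n) (sym d≡) m′<[1+d]n)
             (*-monoʳ-≤ 1 (*-monoˡ-≤ s (m≤m+n 4 4))))
    (≤-trans (≤-reflexive (^-zeroˡ k)) (s≤s z≤n))
  few-branches (suc d) d≡ dᵏ≤ = power-bound {s = s} k (suc d)
    (≤-trans (subst (λ d → suc m′ ≤ suc d * n) (sym d≡) m′<[1+d]n)
             (≤-trans (*-monoˡ-≤ n (s≤s (m≤n+m (suc d) d))) (≤-reflexive (double (suc d) s))))
    dᵏ≤
    where
    double : ∀ x s → (x + x) * (4 * s) ≡ x * (8 * s)
    double = solve-∀

branching-small : ∀ m′ s′ → let d = m′ / (4 * suc s′) in
            d * (suc s′ + suc s′) + d * (suc s′ + suc s′) < suc m′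
branching-small m′ s′ = s≤s (begin
  d * (s + s) + d * (s + s)    ≡⟨ regroup d s ⟩
  d * (4 * s)                  ≤⟨ m/n*n≤m m′ (4 * s) ⟩
  m′                           ∎)
  where
  open ≤-Reasoning
  s = suc s′
  d = m′ / (4 * s)
  regroup : ∀ d s → d * (s + s) + d * (s + s) ≡ d * (4 * s)
  regroup = solve-∀

quarter-bound : ∀ n {ℓ} → ℓ ≤ 2 * (n / 4) → 2 * ℓ ≤ n
quarter-bound n {ℓ} ℓ≤ = begin
  2 * ℓ              ≤⟨ *-monoʳ-≤ 2 ℓ≤ ⟩
  2 * (2 * (n / 4))  ≡⟨ quadruple (n / 4) ⟩
  n / 4 * 4          ≤⟨ m/n*n≤m n 4 ⟩
  n                  ∎
  where
  open ≤-Reasoning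
  quadruple : ∀ k → 2 * (2 * k) ≡ k * 4
  quadruple = solve-∀

lemma8 : (n m s : ℕ) (x y z : Fin m → Fin s)
       → 0 < m
       → (600 * s) ^ suc (n / 4) < m ^ (n / 4)
       → Σ (Cycle x y) λ C₁ → Σ (Cycle y z) λ C₂
           → 2 * length C₁ ≤ n × 2 * length C₂ ≤ n
             × ∃ λ u → HasLabel C₁ u × HasLabel C₂ u
lemma8 n (suc m′) zero x y z _ _ with x zero
... | ()
lemma8 n (suc m′) (suc s′) x y z _ hyp =
  rescale (shared-short-cycles {d = m′ / (4 * suc s′)} {n / 4} x y z
             (branching-large m′ s′ (n / 4) hyp) (branching-small m′ s′))
  where
  rescale : (Σ (Cycle x y) λ C₁ → Σ (Cycle y z) λ C₂ →
               length C₁ ≤ 2 * (n / 4) × length C₂ ≤ 2 * (n / 4) × ∃ λ u → HasLabel C₁ u × HasLabel C₂ u) →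
            Σ (Cycle x y) λ C₁ → Σ (Cycle y z) λ C₂ →
               2 * length C₁ ≤ n × 2 * length C₂ ≤ n × ∃ λ u → HasLabel C₁ u × HasLabel C₂ u
  rescale (C₁ , C₂ , short₁ , short₂ , shared) =
    C₁ , C₂ , quarter-bound n short₁ , quarter-bound n short₂ , shared
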